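{- Let $\alpha$ be a composition, $w\in CRHW_n$ with $w(\alpha)=\beta\ne0$, and $\tau$ the filling of $\beta/\!\!/\alpha$ corresponding to $w$. For every $j\ge1$ that belongs to $\mathrm{supp}(w)$ but is not its greatest element, every entry of $\tau$ in column $j$ other than the greatest one is strictly smaller than the smallest entry of $\tau$ in column $j+1$.
   Context: A composition is a finite sequence of positive integers; its diagram has $\alpha_i$ left-justified boxes in row $i$, rows numbered top to bottom. Box-adding operators: $\mathfrak{t}_1(\alpha)=(1,\alpha_1,\ldots,\alpha_k)$ (a new top row of one box, previous rows moving down one); for $i\ge2$, $\mathfrak{t}_i(\alpha)$ adds one box at the end of the topmost row of length $i-1$ (in column $i$) if one exists, else is $0$; $\mathfrak{t}_i(0)=0$. A word $w=\mathfrak{t}_{i_1}\cdots\mathfrak{t}_{i_n}$ acts by applying $\mathfrak{t}_{i_n}$ first. It is a reverse hookword if for some $0\le k\le n-1$, $i_1\le\cdots\le i_{k+1}>i_{k+2}>\cdots>i_n$; $\mathrm{supp}(w)=\{i_1,\ldots,i_n\}$; $w$ is connected if $\mathrm{supp}(w)$ is a set of consecutive integers; $CRHW_n$ is the set of connected reverse hookwords of length $n$. If $w(\alpha)=\beta\ne0$, the boxes added during the successive applications form the skew shape $\beta/\!\!/\alpha$ (the diagram of $\beta$ minus the diagram of $\alpha$ placed in the bottom $l(\alpha)$ rows); the filling $\tau$ corresponding to $w$ places $n-m+1$ in the $m$-th box added. Columns of $\tau$ refer to boxes of $\beta/\!\!/\alpha$ in a given column. -}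

module Defs where

open import Data.Nat using (ℕ; zero; suc; _+_; _∸_; _≤_; _<_; _>_; _≟_)
open import Data.List using (List; []; _∷_; _++_; [_]; length)
open import Data.List.Relation.Unary.All using (All)
open import Data.List.Relation.Unary.Linked using (Linked)
open import Data.List.Membership.Propositional using (_∈_)
open import Data.Maybe using (Maybe; just; nothing; _>>=_)
open import Data.Product using (_×_; _,_; ∃; ∃-syntax; proj₁; proj₂)
open import Relation.Nullary using (yes; no)
open import Relation.Binary.PropositionalEquality using (_≡_)

-- A composition: a list of positive integers (row 1 = head = top row).
Composition : Set
Composition = List ℕ

IsComposition : List ℕ → Set
IsComposition α = All (1 ≤_) α

-- A box of a diagram, recorded as (row counted from the BOTTOM, starting at 1 ; column, starting at 1).
-- Counting rows from the bottom makes box positions stable under 𝔱₁ (which pushes rows down),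
-- and matches the placement of α in the bottom rows of β for the skew shape β//α.
Box : Set
Box = ℕ × ℕ

column : Box → ℕ
column = proj₂

-- Add a box at the end of the topmost row of length m; returns the new composition and
-- the 0-based index (from the top) of the modified row.
addToTopmost : ℕ → List ℕ → Maybe (List ℕ × ℕ)
addToTopmost m [] = nothing
addToTopmost m (a ∷ α) with a ≟ m
... | yes _ = just (suc a ∷ α , 0)
... | no _ = addToTopmost m α >>= λ { (α' , r) → just (a ∷ α' , suc r) }

-- The operator 𝔱ᵢ, returning also the added box (nothing encodes the result 0).
-- 𝔱₀ is not defined in the paper; we return nothing for it (words are required to have letters ≥ 1 anyway).
step : ℕ → List ℕ → Maybe (List ℕ × Box)
step zero α = nothing
step (suc zero) α = just (1 ∷ α , (suc (length α) , 1))
step (suc (suc k)) α =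
  addToTopmost (suc k) α >>= λ { (α' , r) → just (α' , (length α ∸ r , suc (suc k))) }

-- w = 𝔱_{i₁} ⋯ 𝔱_{iₙ} is the list i₁ ∷ … ∷ iₙ ∷ [] ; 𝔱_{iₙ} is applied first.
-- Returns w(α) together with the added boxes listed in order of addition (first added first).
applyWord : List ℕ → List ℕ → Maybe (List ℕ × List Box)
applyWord [] α = just (α , [])
applyWord (i ∷ w) α =
  applyWord w α >>= λ { (γ , bs) → step i γ >>= λ { (β , b) → just (β , bs ++ [ b ]) } }

-- Label boxes (in order of addition) with entries k, k-1, … : with k = n the m-th added box gets n-m+1.
label : ℕ → List Box → List (Box × ℕ)
label k [] = []
label k (b ∷ bs) = (b , k) ∷ label (k ∸ 1) bs

-- The filling τ of β//α corresponding to w (meaningful when applyWord w α = just (β , bs)).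
filling : List ℕ → List Box → List (Box × ℕ)
filling w bs = label (length w) bs

EntryInColumn : List (Box × ℕ) → ℕ → ℕ → Set
EntryInColumn τ j e = ∃[ b ] ((b , e) ∈ τ × column b ≡ j)

IsReverseHookword : List ℕ → Set
IsReverseHookword w =
  ∃[ u ] ∃[ x ] ∃[ v ] (w ≡ u ++ x ∷ v × Linked _≤_ (u ++ [ x ]) × Linked _>_ (x ∷ v))

IsConnected : List ℕ → Set
IsConnected w = ∀ a b c → a ∈ w → c ∈ w → a ≤ b → b ≤ c → b ∈ w

-- w ∈ CRHW_n (letters are positive integers, as the operators 𝔱ᵢ are indexed by i ≥ 1).
CRHW : ℕ → List ℕ → Set
CRHW n w = All (1 ≤_) w × length w ≡ n × IsReverseHookword w × IsConnected w

-- The box added by the k-th letter of w (from the left, k ≥ 1) carries the entry k and lies in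
-- the column named by that letter.  So the claim is about positions in w: if j occurs at
-- positions k < k′, then k precedes every occurrence of j + 1.  The strictly decreasing tail of
-- a reverse hookword has no repeated letter, so position k lies in the weakly increasing head,
-- before which nothing larger than j can occur.
module Submission where

open import Defs
open import Data.Nat using (ℕ; zero; suc; _+_; _∸_; _≤_; _<_; _>_; z≤n; s≤s)
open import Data.Nat.Properties
  using ( ≤-reflexive; ≤-trans; ≤-pred; <-trans; <-irrefl; ≤⇒≯; <-≤-trans; <-cmp; n<1+n
        ; m≤m+n; +-comm; +-cancelˡ-<; 0∸n≡0; m+n∸n≡m)
open import Data.List using (List; []; _∷_; _++_; [_]; length; map)
open import Data.List.Properties using (++-assoc; length-++)
open import Data.List.Membership.Propositional using (_∈_)
open import Data.List.Membership.Propositional.Properties using (∈-map⁻; ∈-++⁻)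
open import Data.List.Relation.Unary.All as All using ()
open import Data.List.Relation.Unary.AllPairs using (AllPairs; _∷_)
open import Data.List.Relation.Unary.Any using (here; there)
open import Data.List.Relation.Unary.Linked as Linked using (Linked)
open import Data.List.Relation.Unary.Linked.Properties using (Linked⇒AllPairs)
open import Data.Maybe using (Maybe; just; _>>=_)
open import Data.Product using (_×_; _,_; ∃-syntax; map₂)
open import Data.Sum using (_⊎_; inj₁; inj₂)
open import Data.Empty using (⊥-elim)
open import Relation.Binary using (Transitive; tri<; tri≈; tri>)
open import Relation.Binary.PropositionalEquality
  using (_≡_; refl; sym; trans; cong; cong₂; subst; module ≡-Reasoning)

infix 4 _[_]=_

data _[_]=_ {A : Set} : List A → ℕ → A → Set where
  here  : ∀ {x xs} → x ∷ xs [ 0 ]= x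
  there : ∀ {x y xs k} → xs [ k ]= y → x ∷ xs [ suc k ]= y

module _ {A : Set} where

  []=⇒∈ : ∀ {xs : List A} {k x} → xs [ k ]= x → x ∈ xs
  []=⇒∈ here          = here refl
  []=⇒∈ (there xs[k]) = there ([]=⇒∈ xs[k])

  []=-functional : ∀ {xs : List A} {k x y} → xs [ k ]= x → xs [ k ]= y → x ≡ y
  []=-functional here          here          = refl
  []=-functional (there xs[k]) (there xs[k]′) = []=-functional xs[k] xs[k]′

  []=-bound : ∀ {xs : List A} {k x} → xs [ k ]= x → k < length xs
  []=-bound here          = s≤s z≤n
  []=-bound (there xs[k]) = s≤s ([]=-bound xs[k])

  ++-[]=⁻ : ∀ xs {ys : List A} {k x} → xs ++ ys [ k ]= x →
            xs [ k ]= x ⊎ ∃[ m ] (k ≡ length xs + m × ys [ m ]= x)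
  ++-[]=⁻ []       ys[k]     = inj₂ (_ , refl , ys[k])
  ++-[]=⁻ (_ ∷ xs) here      = inj₁ here
  ++-[]=⁻ (_ ∷ xs) (there p) with ++-[]=⁻ xs p
  ... | inj₁ xs[k]              = inj₁ (there xs[k])
  ... | inj₂ (m , refl , ys[m]) = inj₂ (m , refl , ys[m])

  AllPairs-[]= : ∀ {R : A → A → Set} {xs k l x y} → AllPairs R xs →
                 xs [ k ]= x → xs [ l ]= y → k < l → R x y
  AllPairs-[]= (Rx ∷ _)   here          (there xs[l]) _         = All.lookup Rx ([]=⇒∈ xs[l])
  AllPairs-[]= (_ ∷ Rxs)  (there xs[k]) (there xs[l]) (s≤s k<l) = AllPairs-[]= Rxs xs[k] xs[l] k<l
  AllPairs-[]= (_ ∷ _)    _             here          ()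

repeat-in-increasing-part : ∀ {A v : List ℕ} {k k′ x} → Linked _>_ v →
  A ++ v [ k ]= x → A ++ v [ k′ ]= x → k < k′ → A [ k ]= x
repeat-in-increasing-part {A} v↘ w[k] w[k′] k<k′
  with ++-[]=⁻ A w[k] | ++-[]=⁻ A w[k′]
... | inj₁ A[k]              | _                         = A[k]
... | inj₂ (m , refl , _)    | inj₁ A[k′]                =
  ⊥-elim (≤⇒≯ (m≤m+n (length A) m) (<-trans k<k′ ([]=-bound A[k′])))
... | inj₂ (m , refl , v[m]) | inj₂ (m′ , refl , v[m′]) =
  ⊥-elim (<-irrefl refl (AllPairs-[]= (Linked⇒AllPairs >-trans v↘) v[m] v[m′] (+-cancelˡ-< (length A) m m′ k<k′)))
  where
  >-trans : Transitive _>_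
  >-trans x>y y>z = <-trans y>z x>y

increasing-part-precedes-larger : ∀ {A v : List ℕ} {k l x y} → Linked _≤_ A →
  A [ k ]= x → A ++ v [ l ]= y → x < y → k < l
increasing-part-precedes-larger {A} {l = l} A↗ A[k] w[l] x<y with ++-[]=⁻ A w[l]
... | inj₂ (m , refl , _) = <-≤-trans ([]=-bound A[k]) (m≤m+n (length A) m)
... | inj₁ A[l] with <-cmp _ l
...   | tri< k<l _ _    = k<l
...   | tri≈ _ refl _   = ⊥-elim (<-irrefl ([]=-functional A[k] A[l]) x<y)
...   | tri> _ _ l<k    = ⊥-elim (≤⇒≯ (AllPairs-[]= (Linked⇒AllPairs ≤-trans A↗) A[l] A[k] l<k) x<y)

repeated-letter-precedes-larger : ∀ {w k k′ l x y} → IsReverseHookword w →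
  w [ k ]= x → w [ k′ ]= x → k < k′ → w [ l ]= y → x < y → k < l
repeated-letter-precedes-larger (u , z , v , refl , head↗ , tail↘) w[k] w[k′] k<k′ w[l] =
  increasing-part-precedes-larger head↗
    (repeat-in-increasing-part (Linked.tail tail↘) (regroup w[k]) (regroup w[k′]) k<k′)
    (regroup w[l])
  where
  regroup : ∀ {m a} → u ++ z ∷ v [ m ]= a → (u ++ [ z ]) ++ v [ m ]= a
  regroup {m} {a} = subst (_[ m ]= a) (sym (++-assoc u [ z ] v))

>>=-just⁻ : ∀ {A B : Set} (m : Maybe A) {f : A → Maybe B} {y} → (m >>= f) ≡ just y →
  ∃[ x ] (m ≡ just x × f x ≡ just y)
>>=-just⁻ (just x) eq = x , refl , eq

step-column : ∀ i {γ β b} → step i γ ≡ just (β , b) → column b ≡ i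
step-column (suc zero)    refl = refl
step-column (suc (suc k)) {γ} eq with addToTopmost (suc k) γ
step-column (suc (suc k)) refl | just _ = refl

applyWord-∷⁻ : ∀ i w {α β bs} → applyWord (i ∷ w) α ≡ just (β , bs) →
  ∃[ γ ] ∃[ bs′ ] ∃[ b ] (applyWord w α ≡ just (γ , bs′) × step i γ ≡ just (β , b) × bs ≡ bs′ ++ [ b ])
applyWord-∷⁻ i w {α} eq with >>=-just⁻ (applyWord w α) eq
... | (γ , bs′) , w[α] , eq′ with >>=-just⁻ (step i γ) eq′
...   | (β , b) , i[γ] , refl = γ , bs′ , b , w[α] , i[γ] , refl

applyWord-length : ∀ w {α β bs} → applyWord w α ≡ just (β , bs) → length bs ≡ length w
applyWord-length []      refl = refl
applyWord-length (i ∷ w) eq with applyWord-∷⁻ i w eq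
... | _ , bs′ , b , w[α] , _ , refl = begin
  length (bs′ ++ [ b ]) ≡⟨ length-++ bs′ ⟩
  length bs′ + 1        ≡⟨ +-comm (length bs′) 1 ⟩
  suc (length bs′)      ≡⟨ cong suc (applyWord-length w w[α]) ⟩
  suc (length w)        ∎
  where open ≡-Reasoning

label-++ : ∀ k (xs ys : List Box) → label k (xs ++ ys) ≡ label k xs ++ label (k ∸ length xs) ys
label-++ k       []       ys = refl
label-++ zero    (x ∷ xs) ys =
  cong ((x , 0) ∷_) (trans (label-++ 0 xs ys) (cong (λ m → label 0 xs ++ label m ys) (0∸n≡0 (length xs))))
label-++ (suc k) (x ∷ xs) ys = cong ((x , suc k) ∷_) (label-++ k xs ys)

label-suc : ∀ k (xs : List Box) → length xs ≤ k → label (suc k) xs ≡ map (map₂ suc) (label k xs)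
label-suc k       []       _         = refl
label-suc (suc k) (x ∷ xs) (s≤s len) = cong ((x , suc (suc k)) ∷_) (label-suc k xs len)

filling-∷ : ∀ i w (bs : List Box) b → length bs ≡ length w →
  filling (i ∷ w) (bs ++ [ b ]) ≡ map (map₂ suc) (filling w bs) ++ [ (b , 1) ]
filling-∷ i w bs b len = begin
  label (suc n) (bs ++ [ b ])                        ≡⟨ label-++ (suc n) bs [ b ] ⟩
  label (suc n) bs ++ [ (b , suc n ∸ length bs) ]    ≡⟨ cong₂ _++_ (label-suc n bs (≤-reflexive len))
                                                                    (cong (λ m → [ (b , suc n ∸ m) ]) len) ⟩
  map (map₂ suc) (label n bs) ++ [ (b , suc n ∸ n) ] ≡⟨ cong (λ e → map (map₂ suc) (label n bs) ++ [ (b , e) ])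
                                                             (m+n∸n≡m 1 n) ⟩
  map (map₂ suc) (label n bs) ++ [ (b , 1) ]         ∎
  where
  n = length w
  open ≡-Reasoning

filling-entry : ∀ w {α β bs b e} → applyWord w α ≡ just (β , bs) → (b , e) ∈ filling w bs →
  ∃[ k ] (e ≡ suc k × w [ k ]= column b)
filling-entry []      refl ()
filling-entry (i ∷ w) eq b∈ with applyWord-∷⁻ i w eq
... | _ , bs′ , b′ , w[α] , i[γ] , refl
  rewrite filling-∷ i w bs′ b′ (applyWord-length w w[α])
  with ∈-++⁻ (map (map₂ suc) (filling w bs′)) b∈
... | inj₂ (here refl) = 0 , refl , subst (i ∷ w [ 0 ]=_) (sym (step-column i i[γ])) here
... | inj₁ b∈′ with ∈-map⁻ (map₂ suc) b∈′
...   | _ , b∈w , refl with filling-entry w w[α] b∈w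
...     | k , refl , w[k] = suc k , refl , there w[k]

corollary5p8 : (α : List ℕ) → IsComposition α → (n : ℕ) → (w : List ℕ) → CRHW n w →
    (β : List ℕ) → (bs : List Box) → applyWord w α ≡ just (β , bs) →
    (j : ℕ) → 1 ≤ j → j ∈ w → (∃[ j' ] (j' ∈ w × j < j')) →
    (e : ℕ) → EntryInColumn (filling w bs) j e →
    (∃[ e' ] (EntryInColumn (filling w bs) j e' × e < e')) →
    (f : ℕ) → EntryInColumn (filling w bs) (suc j) f → e < f
corollary5p8 α _ n w (_ , _ , hook , _) β bs w[α] j _ _ _
  e (b , b∈ , refl) (e′ , (b′ , b′∈ , col-b′) , e<e′) f (c , c∈ , col-c)
  with filling-entry w w[α] b∈ | filling-entry w w[α] b′∈ | filling-entry w w[α] c∈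
... | k , refl , w[k] | k′ , refl , w[k′] | l , refl , w[l] =
  s≤s (repeated-letter-precedes-larger hook
         w[k] (subst (w [ k′ ]=_) col-b′ w[k′]) (≤-pred e<e′)
         (subst (w [ l ]=_) col-c w[l]) (n<1+n (column b)))
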